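{- Let $\mathbf{x}_{3/2}$ be the lexicographically least infinite word over $\mathbb{N}$ containing no factor that is a $\tfrac{3}{2}$-power. Then the only nonempty squares $xx$ occurring as factors of $\mathbf{x}_{3/2}$ are $00$ and $11$, and $\mathbf{x}_{3/2}$ is overlap-free.
   Context: $\mathbb{N}=\{0,1,2,\ldots\}$. A finite word $x$ is a $\tfrac{3}{2}$-power if $x = y y'$ for some nonempty word $y$ and some prefix $y'$ of $y$ with $|x|/|y| = 3/2$. A square is a word $xx$ with $x$ nonempty. An overlap is a word of the form $axaxa$ with $a$ a single letter and $x$ a possibly empty word; a word is overlap-free if it has no overlap as a factor. -}

module Defs where

open import Data.Nat using (ℕ; zero; suc; _+_; _*_; _<_)
open import Data.List using (List; []; _∷_; _++_; length; [_])
open import Data.Product using (Σ; _×_; ∃; ∃-syntax)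
open import Data.Sum using (_⊎_)
open import Relation.Binary.PropositionalEquality using (_≡_; _≢_)
open import Relation.Nullary using (¬_)

InfWord : Set
InfWord = ℕ → ℕ

Word : Set
Word = List ℕ

factorAt : InfWord → ℕ → ℕ → Word
factorAt w i zero    = []
factorAt w i (suc n) = w i ∷ factorAt w (suc i) n

FactorOf : Word → InfWord → Set
FactorOf x w = ∃[ i ] factorAt w i (length x) ≡ x

ThreeHalvesPower : Word → Set
ThreeHalvesPower x =
  ∃[ y ] ∃[ y' ] (y ≢ []) × (∃[ z ] y ≡ y' ++ z) × (x ≡ y ++ y')
    × (2 * length x ≡ 3 * length y)

ThreeHalvesPowerFree : InfWord → Set
ThreeHalvesPowerFree w = ∀ x → FactorOf x w → ¬ ThreeHalvesPower x

_≤lex_ : InfWord → InfWord → Set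
w ≤lex v = (∀ i → w i ≡ v i) ⊎ (∃[ n ] (∀ i → i < n → w i ≡ v i) × (w n < v n))

IsLexLeast32Free : InfWord → Set
IsLexLeast32Free w = ThreeHalvesPowerFree w × (∀ v → ThreeHalvesPowerFree v → w ≤lex v)

Square : Word → Set
Square x = ∃[ u ] (u ≢ []) × (x ≡ u ++ u)

Overlap : Word → Set
Overlap x = ∃[ a ] ∃[ u ] x ≡ (a ∷ u) ++ (a ∷ u) ++ [ a ]

OverlapFree : InfWord → Set
OverlapFree w = ∀ x → FactorOf x w → ¬ Overlap x

module Submission where

-- The lexicographically least 3/2-power-free word over ℕ is the word X defined by:
-- writing n = r + 6q with r < 6, X n = 2 + X q if r = 5 (a "big" letter), and otherwise
-- X n is letter r of the block 00110 when q is even and of 10011 when q is odd; so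
-- X = 001102 100112 001100 ...
--
-- * Windows: a factor which is a 3/2-power, a square or an overlap is a window agreeing
--   with a shifted copy of itself (Agree); 3/2-powers are exactly the Repetitions.
-- * Structure of X: big letters sit exactly at offset 5 of the blocks, so a window that
--   agrees under a shift p and contains a big letter has 6 ∣ p; shifting by an odd
--   number of blocks flips the block pattern, by an even number preserves it.
-- * X has no repetition (no-repetition): half-periods ≤ 5 by a finite check modulo 12;
--   for half-period k ≥ 6, 2k = 6c with c even, and the big letters 2 + X q then carry a
--   repetition of half-period k/6 (descent by complete induction).
-- * Greediness (blocked): every letter b < X n completes a 3/2-power ending at n, so a
--   3/2-power-free word lexicographically ≤ X is X itself (lex-least-is-X).
-- * A square of X has period 1 and letters < 2, and an overlap would contain a cube aaa.

open import Defs
open import Data.List using (List; []; _∷_)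
open import Data.Product using (_×_)
open import Data.Sum using (_⊎_)
open import Relation.Binary.PropositionalEquality using (_≡_)

open import Data.Bool using (Bool; true; false; not; T; _∧_; _∨_)
open import Data.Empty using (⊥-elim)
open import Data.List using (_++_; length; [_])
open import Data.List.Properties using (length-++; ++-assoc; ∷-injective)
open import Data.Maybe using (Maybe; just; nothing)
open import Data.Nat using (ℕ; zero; suc; _+_; _*_; _∸_; _≤_; _<_; z≤n; s≤s; parity; _≡ᵇ_; _<ᵇ_; ≢-nonZero)
open import Data.Nat.DivMod
  using (_/_; _%_; m≡m%n+[m/n]*n; [m+kn]%n≡m%n; m<n⇒m%n≡m; m<n⇒m/n≡0; m*n/n≡m; +-distrib-/-∣ʳ; m/n<m; m%n<n)
open import Data.Nat.Divisibility using (divides-refl)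
open import Data.Nat.Induction using (<-rec)
open import Data.Nat.Properties
open import Data.Nat.Tactic.RingSolver using (solve-∀)
open import Algebra.Properties.CommutativeSemigroup +-commutativeSemigroup using () renaming (xy∙z≈xz∙y to +-swapʳ)
open import Data.Parity.Base using (Parity; 0ℙ; 1ℙ; _⁻¹) renaming (_+_ to _ℙ+_; _*_ to _ℙ*_)
import Data.Parity.Properties as Parity
open import Data.Product using (∃-syntax; _,_; proj₁; proj₂)
open import Data.Sum using (inj₁; inj₂)
open import Relation.Binary.PropositionalEquality using (refl; sym; trans; cong; cong₂; subst; _≢_; module ≡-Reasoning)
open import Relation.Nullary using (¬_; yes; no)

open ≡-Reasoning

Agree : InfWord → ℕ → ℕ → ℕ → Set
Agree v s t n = ∀ j → j < n → v (s + j) ≡ v (t + j)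

agree-shrink : ∀ {v s t m n} → m ≤ n → Agree v s t n → Agree v s t m
agree-shrink m≤n agree j j<m = agree j (<-≤-trans j<m m≤n)

-- A 3/2-repetition of half-period k at s: the factor v[s .. s+3k) has period 2k.
Repetition : InfWord → ℕ → ℕ → Set
Repetition v s k = Agree v s (s + k * 2) k

factorAt-length : ∀ v i n → length (factorAt v i n) ≡ n
factorAt-length v i zero    = refl
factorAt-length v i (suc n) = cong suc (factorAt-length v (suc i) n)

factorAt-++ : ∀ v i m n → factorAt v i (m + n) ≡ factorAt v i m ++ factorAt v (i + m) n
factorAt-++ v i zero    n = cong (λ i′ → factorAt v i′ n) (sym (+-identityʳ i))
factorAt-++ v i (suc m) n = cong (v i ∷_) (trans (factorAt-++ v (suc i) m n)
  (cong (λ i′ → factorAt v (suc i) m ++ factorAt v i′ n) (sym (+-suc i m))))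

factorAt⇒agree : ∀ v s t n → factorAt v s n ≡ factorAt v t n → Agree v s t n
factorAt⇒agree v s t (suc n) eq zero _ =
  trans (cong v (+-identityʳ s)) (trans (proj₁ (∷-injective eq)) (cong v (sym (+-identityʳ t))))
factorAt⇒agree v s t (suc n) eq (suc j) (s≤s j<n) =
  trans (cong v (+-suc s j))
    (trans (factorAt⇒agree v (suc s) (suc t) n (proj₂ (∷-injective eq)) j j<n)
      (cong v (sym (+-suc t j))))

agree⇒factorAt : ∀ v s t n → Agree v s t n → factorAt v s n ≡ factorAt v t n
agree⇒factorAt v s t zero    agree = refl
agree⇒factorAt v s t (suc n) agree = cong₂ _∷_
  (trans (cong v (sym (+-identityʳ s))) (trans (agree 0 (s≤s z≤n)) (cong v (+-identityʳ t))))
  (agree⇒factorAt v (suc s) (suc t) n λ j j<n →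
    trans (cong v (sym (+-suc s j))) (trans (agree (suc j) (s≤s j<n)) (cong v (+-suc t j))))

factor-transfer : ∀ {v v′ x} → (∀ n → v n ≡ v′ n) → FactorOf x v → FactorOf x v′
factor-transfer {v} {v′} {x} v≡v′ (i , fx) = i , trans (sym (same i (length x))) fx
  where
  same : ∀ i n → factorAt v i n ≡ factorAt v′ i n
  same i zero    = refl
  same i (suc n) = cong₂ _∷_ (v≡v′ i) (same (suc i) n)

++-cancel-length : ∀ {A : Set} (a c : List A) {b d : List A} →
  length a ≡ length c → a ++ b ≡ c ++ d → a ≡ c × b ≡ d
++-cancel-length []      []      _   eq = refl , eq
++-cancel-length (x ∷ a) (y ∷ c) len eq with ∷-injective eq
... | refl , eq′ with ++-cancel-length a c (suc-injective len) eq′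
...   | refl , b≡d = refl , b≡d

factor-split : ∀ v i x y z → factorAt v i (length x) ≡ x → x ≡ y ++ z →
  factorAt v i (length y) ≡ y × factorAt v (i + length y) (length z) ≡ z
factor-split v i .(y ++ z) y z fx refl =
  ++-cancel-length (factorAt v i (length y)) y (factorAt-length v i (length y))
    (trans (sym (factorAt-++ v i (length y) (length z)))
      (trans (cong (factorAt v i) (sym (length-++ y))) fx))

factor-period : ∀ v i x y z t → factorAt v i (length x) ≡ x → x ≡ y ++ z → x ≡ z ++ t →
  Agree v i (i + length y) (length z)
factor-period v i x y z t fx x≡yz x≡zt = factorAt⇒agree v i (i + length y) (length z)
  (trans (proj₁ (factor-split v i x z t fx x≡zt)) (sym (proj₂ (factor-split v i x y z fx x≡yz))))

nonempty : ∀ {A : Set} (xs : List A) → xs ≢ [] → 1 ≤ length xs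
nonempty []       xs≢[] = ⊥-elim (xs≢[] refl)
nonempty (_ ∷ _) _     = s≤s z≤n

-- A 3/2-power yy′ with |yy′| = 3|y|/2 has |y| = 2|y′|.
half-length : ∀ L k → 2 * (L + k) ≡ 3 * L → L ≡ k * 2
half-length L k eq = sym (+-cancelˡ-≡ (L + L) _ _ (begin
  L + L + k * 2 ≡⟨ double L k ⟩
  2 * (L + k)   ≡⟨ eq ⟩
  3 * L         ≡⟨ triple L ⟩
  L + L + L     ∎))
  where
  double : ∀ L k → L + L + k * 2 ≡ 2 * (L + k)
  double = solve-∀
  triple : ∀ L → 3 * L ≡ L + L + L
  triple = solve-∀

threeHalves⇒repetition : ∀ v x → FactorOf x v → ThreeHalvesPower x →
  ∃[ i ] ∃[ k ] 1 ≤ k × Repetition v i k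
threeHalves⇒repetition v x (i , fx) (y , y′ , y≢[] , (z , y≡y′z) , x≡yy′ , len) =
  i , length y′ , k≥1 , subst (λ p → Agree v i (i + p) (length y′)) |y|≡2k period
  where
  |y|≡2k : length y ≡ length y′ * 2
  |y|≡2k = half-length (length y) (length y′) (subst (λ m → 2 * m ≡ 3 * length y)
    (trans (cong length x≡yy′) (length-++ y)) len)
  k≥1 : 1 ≤ length y′
  k≥1 = positive-half (length y′) (subst (1 ≤_) |y|≡2k (nonempty y y≢[]))
    where
    positive-half : ∀ k → 1 ≤ k * 2 → 1 ≤ k
    positive-half zero    ()
    positive-half (suc _) _ = s≤s z≤n
  period : Agree v i (i + length y) (length y′)
  period = factor-period v i x y y′ (z ++ y′) fx x≡yy′
    (trans x≡yy′ (trans (cong (_++ y′) y≡y′z) (++-assoc y′ z y′)))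

repetition⇒threeHalves : ∀ v s k → 1 ≤ k → Repetition v s k → ¬ ThreeHalvesPowerFree v
repetition⇒threeHalves v s k k≥1 rep free =
  free x (s , cong (factorAt v s) (factorAt-length v s (k * 2 + k)))
    (y , y′ , y≢[] , (factorAt v (s + k) k , y≡y′z) , factorAt-++ v s (k * 2) k , len)
  where
  x = factorAt v s (k * 2 + k)
  y = factorAt v s (k * 2)
  y′ = factorAt v (s + k * 2) k
  twice : ∀ k → k * 2 ≡ k + k
  twice = solve-∀
  y≡y′z : y ≡ y′ ++ factorAt v (s + k) k
  y≡y′z = trans (cong (factorAt v s) (twice k))
    (trans (factorAt-++ v s k k) (cong (_++ factorAt v (s + k) k) (agree⇒factorAt v s (s + k * 2) k rep)))
  y≢[] : y ≢ []
  y≢[] y≡[] = <⇒≢ (≤-trans k≥1 (m≤m*n k 2)) (sym (trans (sym (factorAt-length v s (k * 2))) (cong length y≡[])))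
  lengths : ∀ k → 2 * (k * 2 + k) ≡ 3 * (k * 2)
  lengths = solve-∀
  len : 2 * length x ≡ 3 * length y
  len rewrite factorAt-length v s (k * 2 + k) | factorAt-length v s (k * 2) = lengths k

block : Parity → ℕ → ℕ
block 0ℙ 2 = 1
block 0ℙ 3 = 1
block 0ℙ _ = 0
block 1ℙ 0 = 1
block 1ℙ 3 = 1
block 1ℙ 4 = 1
block 1ℙ _ = 0

block<2 : ∀ p r → block p r < 2
block<2 0ℙ 0 = s≤s z≤n
block<2 0ℙ 1 = s≤s z≤n
block<2 0ℙ 2 = s≤s (s≤s z≤n)
block<2 0ℙ 3 = s≤s (s≤s z≤n)
block<2 0ℙ (suc (suc (suc (suc r)))) = s≤s z≤n
block<2 1ℙ 0 = s≤s (s≤s z≤n)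
block<2 1ℙ 1 = s≤s z≤n
block<2 1ℙ 2 = s≤s z≤n
block<2 1ℙ 3 = s≤s (s≤s z≤n)
block<2 1ℙ 4 = s≤s (s≤s z≤n)
block<2 1ℙ (suc (suc (suc (suc (suc r))))) = s≤s z≤n

block-flip : ∀ p → block p 4 ≢ block (p ⁻¹) 4
block-flip 0ℙ ()
block-flip 1ℙ ()

-- Letter at offset r of block q, where rec gives the letters of the word itself.
letterAt : (ℕ → ℕ) → ℕ → ℕ → ℕ
letterAt rec q 5 = 2 + rec q
letterAt rec q r = block (parity q) r

letterAt-cong : ∀ {rec rec′} q r → rec q ≡ rec′ q → letterAt rec q r ≡ letterAt rec′ q r
letterAt-cong q 0 _ = refl
letterAt-cong q 1 _ = refl
letterAt-cong q 2 _ = refl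
letterAt-cong q 3 _ = refl
letterAt-cong q 4 _ = refl
letterAt-cong q 5 e = cong (2 +_) e
letterAt-cong q (suc (suc (suc (suc (suc (suc r)))))) _ = refl

letterAt-small : ∀ {rec q r} → r < 5 → letterAt rec q r ≡ block (parity q) r
letterAt-small {r = 0} _ = refl
letterAt-small {r = 1} _ = refl
letterAt-small {r = 2} _ = refl
letterAt-small {r = 3} _ = refl
letterAt-small {r = 4} _ = refl
letterAt-small {r = suc (suc (suc (suc (suc _))))} (s≤s (s≤s (s≤s (s≤s (s≤s ())))))

-- X is computed with fuel: the recursion n ↦ n / 6 terminates before n steps.
xFuel : ℕ → ℕ → ℕ
xFuel zero    n = 0
xFuel (suc f) n = letterAt (xFuel f) (n / 6) (n % 6)

xFuel-stable : ∀ f g n → n < f → n < g → xFuel f n ≡ xFuel g n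
xFuel-stable (suc f) (suc g) zero    _ _ = refl
xFuel-stable (suc f) (suc g) n@(suc _) (s≤s n≤f) (s≤s n≤g) =
  letterAt-cong (n / 6) (n % 6) (xFuel-stable f g (n / 6) (<-≤-trans q<n n≤f) (<-≤-trans q<n n≤g))
  where
  q<n : n / 6 < n
  q<n = m/n<m n 6 (s≤s (s≤s z≤n))

-- X is opaque: all later reasoning goes through its unfolding equation.
opaque
  X : InfWord
  X n = xFuel (suc n) n

  X-unfold : ∀ n → X n ≡ letterAt X (n / 6) (n % 6)
  X-unfold zero       = refl
  X-unfold n@(suc _) =
    letterAt-cong (n / 6) (n % 6) (xFuel-stable n (suc (n / 6)) (n / 6) (m/n<m n 6 (s≤s (s≤s z≤n))) ≤-refl)

X-block : ∀ r q → r < 6 → X (r + q * 6) ≡ letterAt X q r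
X-block r q r<6 = trans (X-unfold (r + q * 6)) (cong₂ (letterAt X) quotient remainder)
  where
  quotient : (r + q * 6) / 6 ≡ q
  quotient = trans (+-distrib-/-∣ʳ r (divides-refl q)) (cong₂ _+_ (m<n⇒m/n≡0 r<6) (m*n/n≡m q 6))
  remainder : (r + q * 6) % 6 ≡ r
  remainder = trans ([m+kn]%n≡m%n r q 6) (m<n⇒m%n≡m r<6)

X-big : ∀ q → X (5 + q * 6) ≡ 2 + X q
X-big q = X-block 5 q ≤-refl

X-small : ∀ r q → r < 5 → X (r + q * 6) ≡ block (parity q) r
X-small r q r<5 = trans (X-block r q (m<n⇒m<1+n r<5)) (letterAt-small r<5)

two≤X-big : ∀ q → 2 ≤ X (5 + q * 6)
two≤X-big q = subst (2 ≤_) (sym (X-big q)) (s≤s (s≤s z≤n))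

data Position (n : ℕ) : Set where
  small : ∀ r q → r < 5 → n ≡ r + q * 6 → Position n
  big   : ∀ q → n ≡ 5 + q * 6 → Position n

position : ∀ n → Position n
position n with n % 6 <? 5
... | yes r<5 = small (n % 6) (n / 6) r<5 (m≡m%n+[m/n]*n n 6)
... | no  r≮5 = big (n / 6) (trans (m≡m%n+[m/n]*n n 6) (cong (_+ (n / 6) * 6) r≡5))
  where
  r≡5 : n % 6 ≡ 5
  r≡5 = ≤-antisym (≤-pred (m%n<n n 6)) (≮⇒≥ r≮5)

big-letter : ∀ n → 2 ≤ X n → ∃[ q ] n ≡ 5 + q * 6
big-letter n 2≤Xn with position n
... | big q n≡ = q , n≡
... | small r q r<5 refl = ⊥-elim (<⇒≱ (block<2 (parity q) r) (subst (2 ≤_) (X-small r q r<5) 2≤Xn))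

shift-blocks : ∀ {x} o a p i → p ≡ i * 6 → x ≡ o + a * 6 → x + p ≡ o + (a + i) * 6
shift-blocks o a p i refl refl = regroup o a i
  where
  regroup : ∀ o a i → o + a * 6 + i * 6 ≡ o + (a + i) * 6
  regroup = solve-∀

offset5-distance : ∀ {x p a b} → x ≡ 5 + a * 6 → x + p ≡ 5 + b * 6 → p ≡ (b ∸ a) * 6
offset5-distance {x} {p} {a} {b} refl x+p≡ = begin
  p                   ≡⟨ sym (m+n∸m≡n (a * 6) p) ⟩
  a * 6 + p ∸ a * 6   ≡⟨ cong (_∸ a * 6) (+-cancelˡ-≡ 5 _ _ (trans (sym (+-assoc 5 (a * 6) p)) x+p≡)) ⟩
  b * 6 ∸ a * 6       ≡⟨ sym (*-distribʳ-∸ 6 b a) ⟩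
  (b ∸ a) * 6         ∎

big-letter-shift : ∀ {s p n d} → Agree X s (s + p) n → d < n → 2 ≤ X (s + d) → ∃[ c ] p ≡ c * 6
big-letter-shift {s} {p} {n} {d} agree d<n 2≤X =
  let a , at-a = big-letter (s + d) 2≤X
      b , at-b = big-letter (s + d + p) (subst (2 ≤_) (trans (agree d d<n) (cong X (+-swapʳ s p d))) 2≤X)
  in b ∸ a , offset5-distance {a = a} {b} at-a at-b

offset-add : ∀ s {d e} → s % 6 + d ≡ e → s + d ≡ e + s / 6 * 6
offset-add s {d} {e} eq = begin
  s + d                    ≡⟨ cong (_+ d) (m≡m%n+[m/n]*n s 6) ⟩
  s % 6 + s / 6 * 6 + d    ≡⟨ +-swapʳ (s % 6) (s / 6 * 6) d ⟩
  s % 6 + d + s / 6 * 6    ≡⟨ cong (_+ s / 6 * 6) eq ⟩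
  e + s / 6 * 6            ∎

hit-offset : ∀ s t → t < 6 → ∃[ d ] ∃[ a ] d < 6 × s + d ≡ t + a * 6
hit-offset s t t<6 with s % 6 ≤? t
... | yes r≤t = t ∸ s % 6 , s / 6 , ≤-<-trans (m∸n≤m t (s % 6)) t<6 , offset-add s (m+[n∸m]≡n r≤t)
... | no  r≰t = 6 + t ∸ s % 6 , suc (s / 6) , d<6 ,
  trans (offset-add s (m+[n∸m]≡n r≤6+t)) (next-block t (s / 6))
  where
  r≤6+t : s % 6 ≤ 6 + t
  r≤6+t = ≤-trans (≤-pred (m%n<n s 6)) (m≤m+n 5 (suc t))
  d<6 : 6 + t ∸ s % 6 < 6
  d<6 = subst (6 + t ∸ s % 6 <_) (m+n∸n≡m 6 t) (∸-monoʳ-< (≰⇒> r≰t) r≤6+t)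
  next-block : ∀ t q → 6 + t + q * 6 ≡ t + suc q * 6
  next-block = solve-∀

parity-+-even : ∀ a c → parity (a + c * 2) ≡ parity a
parity-+-even a c = begin
  parity (a + c * 2)                ≡⟨ Parity.+-homo-+ a (c * 2) ⟩
  parity a ℙ+ parity (c * 2)        ≡⟨ cong (parity a ℙ+_) (Parity.*-homo-* c 2) ⟩
  parity a ℙ+ (parity c ℙ* 0ℙ)      ≡⟨ cong (parity a ℙ+_) (Parity.*-zeroʳ (parity c)) ⟩
  parity a ℙ+ 0ℙ                    ≡⟨ Parity.+-identityʳ (parity a) ⟩
  parity a                          ∎

parity-+-odd : ∀ a c → parity c ≡ 1ℙ → parity (a + c) ≡ parity a ⁻¹
parity-+-odd a c odd = trans (Parity.+-homo-+ a c) (trans (cong (parity a ℙ+_) odd) (flip (parity a)))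
  where
  flip : ∀ p → p ℙ+ 1ℙ ≡ p ⁻¹
  flip 0ℙ = refl
  flip 1ℙ = refl

even⇒double : ∀ c → parity c ≡ 0ℙ → ∃[ m ] c ≡ m * 2
even⇒double zero          _    = 0 , refl
even⇒double (suc zero)    ()
even⇒double (suc (suc c)) even with even⇒double c even
... | m , refl = suc m , refl

odd⇒successor : ∀ q → parity q ≡ 1ℙ → ∃[ q′ ] q ≡ suc q′ × parity q′ ≡ 0ℙ
odd⇒successor zero     ()
odd⇒successor (suc q′) odd = q′ , refl , trans (sym (Parity.suc-homo-⁻¹ q′)) (cong _⁻¹ odd)

-- Shifting by an odd number of blocks flips the block pattern, visible within 6 letters.
odd-shift : ∀ {s c n} → parity c ≡ 1ℙ → 6 ≤ n → ¬ Agree X s (s + c * 6) n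
odd-shift {s} {c} odd 6≤n agree =
  let d , a , d<6 , at-a = hit-offset s 4 4<6
  in block-flip (parity a) (begin
    block (parity a) 4        ≡⟨ sym (X-small 4 a 4<5) ⟩
    X (4 + a * 6)             ≡⟨ cong X (sym at-a) ⟩
    X (s + d)                 ≡⟨ agree d (<-≤-trans d<6 6≤n) ⟩
    X (s + c * 6 + d)         ≡⟨ cong X (trans (+-swapʳ s (c * 6) d) (shift-blocks 4 a (c * 6) c refl at-a)) ⟩
    X (4 + (a + c) * 6)       ≡⟨ X-small 4 (a + c) 4<5 ⟩
    block (parity (a + c)) 4  ≡⟨ cong (λ p → block p 4) (parity-+-odd a c odd) ⟩
    block (parity a ⁻¹) 4     ∎)
  where
  4<5 : 4 < 5
  4<5 = ≤-refl
  4<6 : 4 < 6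
  4<6 = m<n⇒m<1+n 4<5

-- Desubstitution: windows agreeing on m consecutive big letters 2 + X a, 2 + X b, ...
-- yield agreement of X on the windows at a and b.
contract : ∀ {s t n d a b} m → d < 6 → m * 6 ≤ n →
  s + d ≡ 5 + a * 6 → t + d ≡ 5 + b * 6 → Agree X s t n → Agree X a b m
contract {s} {t} {n} {d} {a} {b} m d<6 m6≤n at-a at-b agree i i<m = +-cancelˡ-≡ 2 _ _ (begin
  2 + X (a + i)             ≡⟨ sym (X-big (a + i)) ⟩
  X (5 + (a + i) * 6)       ≡⟨ cong X (sym (position-in s a at-a)) ⟩
  X (s + (d + i * 6))       ≡⟨ agree (d + i * 6) inside ⟩
  X (t + (d + i * 6))       ≡⟨ cong X (position-in t b at-b) ⟩
  X (5 + (b + i) * 6)       ≡⟨ X-big (b + i) ⟩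
  2 + X (b + i)             ∎)
  where
  position-in : ∀ x e → x + d ≡ 5 + e * 6 → x + (d + i * 6) ≡ 5 + (e + i) * 6
  position-in x e at = trans (sym (+-assoc x d (i * 6))) (shift-blocks 5 e (i * 6) i refl at)
  inside : d + i * 6 < n
  inside = <-≤-trans (+-monoˡ-< (i * 6) d<6) (≤-trans (*-monoˡ-≤ 6 i<m) m6≤n)

-- The letter at offset r of block q with big letters forgotten; it only depends on the
-- parity of q, which makes X 12-periodic up to big letters.
skeleton : ℕ → ℕ → Maybe ℕ
skeleton q 5 = nothing
skeleton q r = just (block (parity q) r)

shape : ℕ → Maybe ℕ
shape t = skeleton (t / 6) (t % 6)

Fits : Maybe ℕ → ℕ → Set
Fits nothing  x = 2 ≤ x
Fits (just b) x = x ≡ b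

letter-fits : ∀ q a r → r < 6 → Fits (skeleton q r) (letterAt X (q + a * 2) r)
letter-fits q a 0 _ = cong (λ p → block p 0) (parity-+-even q a)
letter-fits q a 1 _ = cong (λ p → block p 1) (parity-+-even q a)
letter-fits q a 2 _ = cong (λ p → block p 2) (parity-+-even q a)
letter-fits q a 3 _ = cong (λ p → block p 3) (parity-+-even q a)
letter-fits q a 4 _ = cong (λ p → block p 4) (parity-+-even q a)
letter-fits q a 5 _ = s≤s (s≤s z≤n)
letter-fits q a (suc (suc (suc (suc (suc (suc _)))))) (s≤s (s≤s (s≤s (s≤s (s≤s (s≤s ()))))))

X-fits : ∀ t a → Fits (shape t) (X (t + a * 12))
X-fits t a = subst (Fits (shape t)) (sym (trans (cong X t+12a≡) (X-block (t % 6) (t / 6 + a * 2) (m%n<n t 6))))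
  (letter-fits (t / 6) a (t % 6) (m%n<n t 6))
  where
  regroup : ∀ r q a → r + q * 6 + a * 12 ≡ r + (q + a * 2) * 6
  regroup = solve-∀
  t+12a≡ : t + a * 12 ≡ t % 6 + (t / 6 + a * 2) * 6
  t+12a≡ = trans (cong (_+ a * 12) (m≡m%n+[m/n]*n t 6)) (regroup (t % 6) (t / 6) a)

distinct : Maybe ℕ → Maybe ℕ → Bool
distinct (just b) (just b′) = not (b ≡ᵇ b′)
distinct (just b) nothing   = b <ᵇ 2
distinct nothing  (just b′) = b′ <ᵇ 2
distinct nothing  nothing   = false

distinct-sound : ∀ m m′ {x y} → T (distinct m m′) → Fits m x → Fits m′ y → x ≢ y
distinct-sound (just b) (just b′) test refl refl b≡b′ = T-not test (≡⇒≡ᵇ b b′ b≡b′)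
  where
  T-not : ∀ {t} → T (not t) → ¬ T t
  T-not {false} _ ()
distinct-sound (just b) nothing test refl 2≤y refl = <⇒≱ (<ᵇ⇒< b 2 test) 2≤y
distinct-sound nothing (just b′) test 2≤x refl refl = <⇒≱ (<ᵇ⇒< b′ 2 test) 2≤x
distinct-sound nothing nothing () _ _

anyBelow : ℕ → (ℕ → Bool) → Bool
anyBelow zero    f = false
anyBelow (suc n) f = f n ∨ anyBelow n f

allBelow : ℕ → (ℕ → Bool) → Bool
allBelow zero    f = true
allBelow (suc n) f = f n ∧ allBelow n f

anyBelow-sound : ∀ n f → T (anyBelow n f) → ∃[ j ] j < n × T (f j)
anyBelow-sound zero    f ()
anyBelow-sound (suc n) f test with f n in fn
... | true  = n , ≤-refl , subst T (sym fn) _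
... | false = let j , j<n , fj = anyBelow-sound n f test in j , m<n⇒m<1+n j<n , fj

allBelow-sound : ∀ n f → T (allBelow n f) → ∀ j → j < n → T (f j)
allBelow-sound (suc n) f test j (s≤s j≤n) with f n in fn | m≤n⇒m<n∨m≡n j≤n
... | true | inj₁ j<n = allBelow-sound n f test j j<n
... | true | inj₂ refl = subst T (sym fn) _
... | false | _        = ⊥-elim test

pair-distinct : ℕ → ℕ → ℕ → Bool
pair-distinct r k j = distinct (shape (r + j)) (shape (r + (suc k * 2 + j)))

-- A finite computation: every repetition of half-period 1..5 starting at a residue
-- r < 12 contains a certainly different letter pair.
short-check : T (allBelow 12 λ r → allBelow 5 λ k → anyBelow (suc k) (pair-distinct r k))
short-check = _

-- Hence, by 12-periodicity, X has no repetition of half-period 1..5.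
short-repetition : ∀ {s k} → k < 5 → ¬ Repetition X s (suc k)
short-repetition {s} {k} k<5 rep =
  let for-r = allBelow-sound 12 (λ r → allBelow 5 λ k → anyBelow (suc k) (pair-distinct r k))
                short-check r (m%n<n s 12)
      for-k = allBelow-sound 5 (λ k → anyBelow (suc k) (pair-distinct r k)) for-r k k<5
      j , j≤k , test = anyBelow-sound (suc k) (pair-distinct r k) for-k
  in distinct-sound (shape (r + j)) (shape (r + (suc k * 2 + j))) test
       (X-fits (r + j) a) (X-fits (r + (suc k * 2 + j)) a)
       (begin
         X (r + j + a * 12)                ≡⟨ cong X (sym (in-period j)) ⟩
         X (s + j)                         ≡⟨ rep j j≤k ⟩
         X (s + suc k * 2 + j)             ≡⟨ cong X (trans (+-assoc s (suc k * 2) j) (in-period (suc k * 2 + j))) ⟩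
         X (r + (suc k * 2 + j) + a * 12)  ∎)
  where
  r = s % 12
  a = s / 12
  in-period : ∀ p → s + p ≡ r + p + a * 12
  in-period p = trans (cong (_+ p) (m≡m%n+[m/n]*n s 12)) (+-swapʳ r (a * 12) p)

-- For half-period k ≥ 6 the big letters force 2k = 6c; odd c contradicts the block
-- pattern and even c gives a repetition of half-period k/6 among the big letters.
long-repetition : ∀ {s k} → 6 ≤ k → (∀ {m} → m < k → ∀ s′ → Repetition X s′ m → m ≡ 0) →
  ¬ Repetition X s k
long-repetition {s} {k} 6≤k shorter rep
  with hit-offset s 5 ≤-refl
... | d , a , d<6 , at-a
  with big-letter-shift {s} {k * 2} {k} {d} rep (<-≤-trans d<6 6≤k) (subst (λ x → 2 ≤ X x) (sym at-a) (two≤X-big a))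
... | c , 2k≡6c
  with parity c in parity-c
... | 1ℙ = odd-shift {s} {c} {k} parity-c 6≤k (subst (λ p → Agree X s (s + p) k) 2k≡6c rep)
... | 0ℙ
  with even⇒double c parity-c
... | m , refl = m≢0 (shorter m<k a
  (contract {s} {s + k * 2} {k} {d} {a} {a + m * 2} m d<6 (≤-reflexive (sym k≡6m)) at-a at-b rep))
  where
  reorder : ∀ m → m * 2 * 6 ≡ m * 6 * 2
  reorder = solve-∀
  k≡6m : k ≡ m * 6
  k≡6m = *-cancelʳ-≡ k (m * 6) 2 (trans 2k≡6c (reorder m))
  m≢0 : m ≢ 0
  m≢0 refl = <⇒≱ 6≤k (≤-trans (≤-reflexive k≡6m) z≤n)
  m<k : m < k
  m<k = subst (m <_) (sym k≡6m) (m<m*n m 6 {{≢-nonZero m≢0}} (s≤s (s≤s z≤n)))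
  at-b : s + k * 2 + d ≡ 5 + (a + m * 2) * 6
  at-b = trans (+-swapʳ s (k * 2) d) (shift-blocks 5 a (k * 2) (m * 2) 2k≡6c at-a)

no-repetition : ∀ k s → Repetition X s k → k ≡ 0
no-repetition = <-rec (λ k → ∀ s → Repetition X s k → k ≡ 0) step
  where
  step : ∀ k → (∀ {m} → m < k → ∀ s → Repetition X s m → m ≡ 0) → ∀ s → Repetition X s k → k ≡ 0
  step zero    _       _ _   = refl
  step (suc k) shorter s rep with k <? 5
  ... | yes k<5 = ⊥-elim (short-repetition {s} k<5 rep)
  ... | no  k≮5 = ⊥-elim (long-repetition {s} (s≤s (≮⇒≥ k≮5)) shorter rep)

X-free : ThreeHalvesPowerFree X
X-free x factor power with threeHalves⇒repetition X x factor power
... | i , k , 1≤k , rep = <⇒≢ 1≤k (sym (no-repetition k i rep))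

-- Writing b at position n of X would complete the 3/2-power X[s .. n] of half-period
-- k + 1: its first k letters repeat 2(k + 1) positions later, and X[s + k] = b.
Blocked : ℕ → ℕ → Set
Blocked n b = ∃[ s ] ∃[ k ] n ≡ s + suc k * 2 + k × Agree X s (s + suc k * 2) k × X (s + k) ≡ b

into-block : ∀ a r i → a * 6 + (r + i * 6) ≡ r + (a + i) * 6
into-block = solve-∀

-- Scaling by the block structure: a shift by an even number of blocks preserves small
-- letters, and the big letters of the blocks reproduce the agreement at level a.
lift : ∀ a c m → Agree X a (a + c * 2) m → Agree X (a * 6) ((a + c * 2) * 6) (5 + m * 6)
lift a c m agree j j<5+6m with position j
... | small r i r<5 refl = begin
  X (a * 6 + (r + i * 6))           ≡⟨ cong X (into-block a r i) ⟩
  X (r + (a + i) * 6)               ≡⟨ X-small r (a + i) r<5 ⟩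
  block (parity (a + i)) r          ≡⟨ cong (λ p → block p r) (same-parity a c i) ⟩
  block (parity (a + c * 2 + i)) r  ≡⟨ sym (X-small r (a + c * 2 + i) r<5) ⟩
  X (r + (a + c * 2 + i) * 6)       ≡⟨ cong X (sym (into-block (a + c * 2) r i)) ⟩
  X ((a + c * 2) * 6 + (r + i * 6)) ∎
  where
  regroup : ∀ a c i → a + c * 2 + i ≡ a + i + c * 2
  regroup = solve-∀
  same-parity : ∀ a c i → parity (a + i) ≡ parity (a + c * 2 + i)
  same-parity a c i = sym (trans (cong parity (regroup a c i)) (parity-+-even (a + i) c))
... | big i refl = begin
  X (a * 6 + (5 + i * 6))           ≡⟨ cong X (into-block a 5 i) ⟩
  X (5 + (a + i) * 6)               ≡⟨ X-big (a + i) ⟩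
  2 + X (a + i)                     ≡⟨ cong (2 +_) (agree i i<m) ⟩
  2 + X (a + c * 2 + i)             ≡⟨ sym (X-big (a + c * 2 + i)) ⟩
  X (5 + (a + c * 2 + i) * 6)       ≡⟨ cong X (sym (into-block (a + c * 2) 5 i)) ⟩
  X ((a + c * 2) * 6 + (5 + i * 6)) ∎
  where
  i<m : i < m
  i<m = *-cancelʳ-< _ i m (+-cancelˡ-< 5 (i * 6) (m * 6) j<5+6m)

block-0≡4 : ∀ p → block p 0 ≡ block p 4
block-0≡4 0ℙ = refl
block-0≡4 1ℙ = refl

block-1 : ∀ p → block p 1 ≡ 0
block-1 0ℙ = refl
block-1 1ℙ = refl

block-3 : ∀ p → block p 3 ≡ 1
block-3 0ℙ = refl
block-3 1ℙ = refl

zero-two-before : ∀ r q p → parity q ≡ p → r < 5 → block p r ≡ 0 →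
  ∃[ s ] suc (suc r) + q * 6 ≡ s + 2 × X s ≡ 0
zero-two-before r q p parity-q r<5 is-zero = r + q * 6 , back r q ,
  trans (X-small r q r<5) (trans (cong (λ p → block p r) parity-q) is-zero)
  where
  back : ∀ r q → suc (suc r) + q * 6 ≡ r + q * 6 + 2
  back = solve-∀

-- A small letter 1 of X is always preceded, two positions earlier, by a 0.
small-letter-blocked : ∀ r q b → r < 5 → b < block (parity q) r → ∃[ s ] r + q * 6 ≡ s + 2 × X s ≡ b
small-letter-blocked r q b r<5 b<letter with parity q in parity-q
small-letter-blocked 0 q _ _ (s≤s z≤n) | 1ℙ with odd⇒successor q parity-q
... | q′ , refl , parity-q′ =
  4 + q′ * 6 , back q′ , trans (X-small 4 q′ ≤-refl) (cong (λ p → block p 4) parity-q′)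
  where
  back : ∀ q′ → suc q′ * 6 ≡ 4 + q′ * 6 + 2
  back = solve-∀
small-letter-blocked 2 q _ _ (s≤s z≤n) | 0ℙ = zero-two-before 0 q 0ℙ parity-q (s≤s z≤n) refl
small-letter-blocked 3 q _ _ (s≤s z≤n) | 0ℙ = zero-two-before 1 q 0ℙ parity-q (s≤s (s≤s z≤n)) refl
small-letter-blocked 3 q _ _ (s≤s z≤n) | 1ℙ = zero-two-before 1 q 1ℙ parity-q (s≤s (s≤s z≤n)) refl
small-letter-blocked 4 q _ _ (s≤s z≤n) | 1ℙ = zero-two-before 2 q 1ℙ parity-q (s≤s (s≤s (s≤s z≤n))) refl
small-letter-blocked 0 q _ _ () | 0ℙ
small-letter-blocked 1 q _ _ () | 0ℙ
small-letter-blocked 1 q _ _ () | 1ℙ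
small-letter-blocked 2 q _ _ () | 1ℙ
small-letter-blocked 4 q _ _ () | 0ℙ
small-letter-blocked (suc (suc (suc (suc (suc _))))) q _ (s≤s (s≤s (s≤s (s≤s (s≤s ()))))) _ | _

lift-blocked : ∀ q b → Blocked q b → Blocked (5 + q * 6) (2 + b)
lift-blocked q b (s , k , refl , agree , last) = s * 6 , 5 + k * 6 , blocks s k ,
  subst (λ t → Agree X (s * 6) t (5 + k * 6)) (scale s k) (lift s (suc k) k agree) ,
  trans (cong X (into-block s 5 k)) (trans (X-big (s + k)) (cong (2 +_) last))
  where
  blocks : ∀ s k → 5 + (s + suc k * 2 + k) * 6 ≡ s * 6 + suc (5 + k * 6) * 2 + (5 + k * 6)
  blocks = solve-∀
  scale : ∀ s k → (s + suc k * 2) * 6 ≡ s * 6 + suc (5 + k * 6) * 2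
  scale = solve-∀

-- Letters below 2 + X q are blocked at the big position of block q: 0 by X[6q] = X[6q + 4]
-- followed by a 0, 1 by X[6q + 3] = 1, and 2 + b by lifting the blocking of b at q.
big-letter-blocked : ∀ q b → b < 2 + X q → (∀ b′ → b′ < X q → Blocked q b′) → Blocked (5 + q * 6) b
big-letter-blocked q 0 _ _ = q * 6 , 1 , position-0 q , agree-0 , last-0
  where
  position-0 : ∀ q → 5 + q * 6 ≡ q * 6 + 2 * 2 + 1
  position-0 = solve-∀
  offset-4 : ∀ q → q * 6 + 4 + 0 ≡ 4 + q * 6
  offset-4 = solve-∀
  agree-0 : Agree X (q * 6) (q * 6 + 2 * 2) 1
  agree-0 0 _ = begin
    X (q * 6 + 0)      ≡⟨ cong X (+-identityʳ (q * 6)) ⟩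
    X (q * 6)          ≡⟨ X-small 0 q (s≤s z≤n) ⟩
    block (parity q) 0 ≡⟨ block-0≡4 (parity q) ⟩
    block (parity q) 4 ≡⟨ sym (X-small 4 q ≤-refl) ⟩
    X (4 + q * 6)      ≡⟨ cong X (sym (offset-4 q)) ⟩
    X (q * 6 + 4 + 0)  ∎
  agree-0 (suc _) (s≤s ())
  last-0 : X (q * 6 + 1) ≡ 0
  last-0 = trans (cong X (+-comm (q * 6) 1)) (trans (X-small 1 q (s≤s (s≤s z≤n))) (block-1 (parity q)))
big-letter-blocked q 1 _ _ = 3 + q * 6 , 0 , position-1 q , (λ _ ()) , last-1
  where
  position-1 : ∀ q → 5 + q * 6 ≡ 3 + q * 6 + 1 * 2 + 0
  position-1 = solve-∀
  last-1 : X (3 + q * 6 + 0) ≡ 1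
  last-1 = trans (cong X (+-identityʳ (3 + q * 6))) (trans (X-small 3 q (s≤s (s≤s (s≤s (s≤s z≤n))))) (block-3 (parity q)))
big-letter-blocked q (suc (suc b)) (s≤s (s≤s b<Xq)) blocked-at-q = lift-blocked q b (blocked-at-q b b<Xq)

blocked : ∀ n b → b < X n → Blocked n b
blocked = <-rec (λ n → ∀ b → b < X n → Blocked n b) step
  where
  step : ∀ n → (∀ {m} → m < n → ∀ b → b < X m → Blocked m b) → ∀ b → b < X n → Blocked n b
  step n earlier b b<X with position n
  ... | small r q r<5 refl =
    let s , n≡ , last = small-letter-blocked r q b r<5 (subst (b <_) (X-small r q r<5) b<X)
    in s , 0 , trans n≡ (sym (+-identityʳ (s + 2))) , (λ _ ()) , trans (cong X (+-identityʳ s)) last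
  ... | big q refl = big-letter-blocked q b (subst (b <_) (X-big q) b<X)
    (earlier (s≤s (≤-trans (m≤m*n q 6) (m≤n+m (q * 6) 4))))

-- A 3/2-power-free word that is lexicographically at most X coincides with X: at the
-- first difference n it has a letter b < X n, which completes a 3/2-power.
lex-least-is-X : ∀ w → IsLexLeast32Free w → ∀ n → w n ≡ X n
lex-least-is-X w (w-free , least) with least X X-free
... | inj₁ same = same
... | inj₂ (n , same-below , w<X) with blocked n (w n) w<X
...   | s , k , refl , agree , last =
  ⊥-elim (repetition⇒threeHalves w s (suc k) (s≤s z≤n) repetition w-free)
  where
  start<n : ∀ {j} → j ≤ k → s + j < s + suc k * 2 + k
  start<n j≤k = ≤-<-trans (+-monoʳ-≤ s j≤k) (+-monoˡ-< k (m<m+n s (s≤s z≤n)))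
  repetition : Repetition w s (suc k)
  repetition j (s≤s j≤k) with m≤n⇒m<n∨m≡n j≤k
  ... | inj₁ j<k = begin
    w (s + j)               ≡⟨ same-below (s + j) (start<n j≤k) ⟩
    X (s + j)               ≡⟨ agree j j<k ⟩
    X (s + suc k * 2 + j)   ≡⟨ sym (same-below _ (+-monoʳ-< (s + suc k * 2) j<k)) ⟩
    w (s + suc k * 2 + j)   ∎
  ... | inj₂ refl = begin
    w (s + j)               ≡⟨ same-below (s + j) (start<n j≤k) ⟩
    X (s + j)               ≡⟨ last ⟩
    w (s + suc k * 2 + j)   ∎

-- A square window of period 2m contains a repetition of half-period m.
no-even-square : ∀ {i} m → Agree X i (i + m * 2) (m * 2) → m ≡ 0
no-even-square {i} m agree = no-repetition m i (agree-shrink {X} {i} {i + m * 2} {m} {m * 2} (m≤m*n m 2) agree)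

fold-into-first-half : ∀ {v i L d} → Agree v i (i + L) L → d < L + L →
  ∃[ d′ ] d′ < L × v (i + d′) ≡ v (i + d)
fold-into-first-half {v} {i} {L} {d} agree d<2L with d <? L
... | yes d<L = d , d<L , refl
... | no  d≮L = d ∸ L , d∸L<L , trans (agree (d ∸ L) d∸L<L) (cong v back)
  where
  L≤d : L ≤ d
  L≤d = ≮⇒≥ d≮L
  d∸L<L : d ∸ L < L
  d∸L<L = +-cancelˡ-< L (d ∸ L) L (subst (_< L + L) (sym (m+[n∸m]≡n L≤d)) d<2L)
  back : i + L + (d ∸ L) ≡ i + d
  back = trans (+-assoc i L (d ∸ L)) (cong (i +_) (m+[n∸m]≡n L≤d))

-- Squares in X have period 1: period 2 is a 3/2-power, and a longer square contains a
-- big letter, so its period is a multiple of 6, hence even.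
square-period-one : ∀ {i L} → 1 ≤ L → Agree X i (i + L) L → L ≡ 1
square-period-one {L = 0} () _
square-period-one {L = 1} _ _ = refl
square-period-one {i} {L = 2} _ agree = ⊥-elim (1+n≢0 (no-even-square {i} 1 agree))
square-period-one {i} {L = L@(suc (suc (suc _)))} _ agree =
  let d , a , d<6 , at-a = hit-offset i 5 ≤-refl
      d′ , d′<L , same = fold-into-first-half {X} {i} {L} {d} agree (≤-trans d<6 6≤L+L)
      big = subst (2 ≤_) (trans (cong X (sym at-a)) (sym same)) (two≤X-big a)
      c , L≡6c = big-letter-shift {i} {L} {L} {d′} agree d′<L big
      L≡[3c]*2 = trans L≡6c (regroup c)
      3c≡0 = no-even-square (c * 3) (subst (λ p → Agree X i (i + p) p) L≡[3c]*2 agree)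
  in ⊥-elim (1+n≢0 (trans L≡[3c]*2 (cong (_* 2) 3c≡0)))
  where
  6≤L+L : 6 ≤ L + L
  6≤L+L = +-mono-≤ {3} {L} {3} {L} (s≤s (s≤s (s≤s z≤n))) (s≤s (s≤s (s≤s z≤n)))
  regroup : ∀ c → c * 6 ≡ c * 3 * 2
  regroup = solve-∀

-- Two equal consecutive letters of X are small: big letters are 6 apart.
equal-neighbours-small : ∀ {i} → Agree X i (i + 1) 1 → X i < 2
equal-neighbours-small {i} agree with 2 ≤? X i
... | no  X≱2 = ≰⇒> X≱2
... | yes 2≤X = ⊥-elim (not-multiple (big-letter-shift {i} {1} {1} {0} agree (s≤s z≤n)
                          (subst (2 ≤_) (cong X (sym (+-identityʳ i))) 2≤X)))
  where
  not-multiple : ¬ (∃[ c ] 1 ≡ c * 6)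
  not-multiple (zero  , ())
  not-multiple (suc _ , ())

small-square : ∀ c → c < 2 → c ∷ c ∷ [] ≡ 0 ∷ 0 ∷ [] ⊎ c ∷ c ∷ [] ≡ 1 ∷ 1 ∷ []
small-square 0 _ = inj₁ refl
small-square 1 _ = inj₂ refl
small-square (suc (suc _)) (s≤s (s≤s ()))

squares-of-X : ∀ x → FactorOf x X → Square x → x ≡ 0 ∷ 0 ∷ [] ⊎ x ≡ 1 ∷ 1 ∷ []
squares-of-X .(u ++ u) (i , fx) (u , u≢[] , refl) =
  square-letters u (square-period-one (nonempty u u≢[]) (factor-period X i (u ++ u) u u u fx refl refl)) fx
  where
  square-letters : ∀ u → length u ≡ 1 → factorAt X i (length (u ++ u)) ≡ u ++ u →
    u ++ u ≡ 0 ∷ 0 ∷ [] ⊎ u ++ u ≡ 1 ∷ 1 ∷ []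
  square-letters []            ()
  square-letters (_ ∷ _ ∷ _)   ()
  square-letters (c ∷ []) _ fx = small-square c (subst (_< 2) (proj₁ (∷-injective fx))
    (equal-neighbours-small (factor-period X i (c ∷ c ∷ []) [ c ] [ c ] [ c ] fx refl refl)))

overlap-period : ∀ v i a u → factorAt v i (length ((a ∷ u) ++ (a ∷ u) ++ [ a ])) ≡ (a ∷ u) ++ (a ∷ u) ++ [ a ] →
  Agree v i (i + length (a ∷ u)) (length ((a ∷ u) ++ [ a ]))
overlap-period v i a u fx = factor-period v i _ (a ∷ u) ((a ∷ u) ++ [ a ]) (u ++ [ a ]) fx refl
  (cong (a ∷_) (sym (++-assoc u [ a ] (u ++ [ a ]))))

cube : ∀ {v i} → Agree v i (i + 1) 2 → Repetition v i 1
cube {v} {i} agree 0 _ = begin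
  v (i + 0)          ≡⟨ agree 0 (s≤s z≤n) ⟩
  v (i + 1 + 0)      ≡⟨ cong v (+-identityʳ (i + 1)) ⟩
  v (i + 1)          ≡⟨ agree 1 (s≤s (s≤s z≤n)) ⟩
  v (i + 1 + 1)      ≡⟨ cong v (two-steps i) ⟩
  v (i + 1 * 2 + 0)  ∎
  where
  two-steps : ∀ i → i + 1 + 1 ≡ i + 1 * 2 + 0
  two-steps = solve-∀
cube _ (suc _) (s≤s ())

-- X is overlap-free: the square inside an overlap has period 1, leaving a cube.
overlap-free-X : OverlapFree X
overlap-free-X x (i , fx) (a , [] , refl) =
  1+n≢0 (no-repetition 1 i (cube {X} {i} (overlap-period X i a [] fx)))
overlap-free-X x (i , fx) (a , b ∷ u , refl) =
  1+n≢0 (suc-injective (square-period-one {i} (s≤s z≤n)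
    (agree-shrink {X} {i} {i + length (a ∷ b ∷ u)} square-part (overlap-period X i a (b ∷ u) fx))))
  where
  square-part : length (a ∷ b ∷ u) ≤ length ((a ∷ b ∷ u) ++ [ a ])
  square-part = s≤s (s≤s (subst (length u ≤_) (sym (length-++ u)) (m≤m+n (length u) 1)))

X-00 : FactorOf (0 ∷ 0 ∷ []) X
X-00 = 0 , cong₂ (λ a b → a ∷ b ∷ []) (X-small 0 0 (s≤s z≤n)) (X-small 1 0 (s≤s (s≤s z≤n)))

X-11 : FactorOf (1 ∷ 1 ∷ []) X
X-11 = 2 , cong₂ (λ a b → a ∷ b ∷ []) (X-small 2 0 (s≤s (s≤s (s≤s z≤n)))) (X-small 3 0 (s≤s (s≤s (s≤s (s≤s z≤n)))))

mainTheorem5 : (w : InfWord) → IsLexLeast32Free w →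
    ((∀ x → FactorOf x w → Square x → (x ≡ 0 ∷ 0 ∷ []) ⊎ (x ≡ 1 ∷ 1 ∷ []))
      × FactorOf (0 ∷ 0 ∷ []) w × FactorOf (1 ∷ 1 ∷ []) w)
    × OverlapFree w
mainTheorem5 w least =
  ( (λ x factor → squares-of-X x (to-X factor))
  , factor-transfer X≡w X-00
  , factor-transfer X≡w X-11 )
  , λ x factor → overlap-free-X x (to-X factor)
  where
  w≡X : ∀ n → w n ≡ X n
  w≡X = lex-least-is-X w least
  X≡w : ∀ n → X n ≡ w n
  X≡w n = sym (w≡X n)
  to-X : ∀ {x} → FactorOf x w → FactorOf x X
  to-X = factor-transfer w≡X
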